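{- Let $\mathcal{H}=\{G_1,\dots,G_k\}$ be a family of pairwise disjoint non-trivial connected graphs and let $G[\mathcal{H}]$ be a graph obtained by point-attaching from $\mathcal{H}$. Suppose $G[\mathcal{H}]$ is not bipartite. Then $$\dim_l(G[\mathcal{H}])\le \sum_{j\in J_{\mathcal{H}}}\bigl(\dim_l(G_j)-\alpha_j\bigr).$$
   Context: All graphs are finite, simple. For a connected graph $G$, $d_G(x,y)$ is the length of a shortest $x$–$y$ path. A set $W\subseteq V(G)$ is a local metric generator for $G$ if for every pair of adjacent vertices $u,v$ there is $w\in W$ with $d_G(u,w)\neq d_G(v,w)$. The local metric dimension $\dim_l(G)$ is the minimum cardinality of a local metric generator; a local metric generator of that cardinality is a local metric basis. Point-attaching: starting from $G_1$, for $i=1,\dots,k-1$, select a vertex of the already constructed graph and a vertex of $G_{i+1}$ and identify them; the result $G[\mathcal{H}]$ is said to be obtained by point-attaching from $G_1,\dots,G_k$, and the $G_i$ (viewed as subgraphs of $G[\mathcal{H}]$) are its primary subgraphs. Attachment vertices are the vertices of $G[\mathcal{H}]$ obtained by identifying vertices of different primary subgraphs. For an attachment vertex $x$ and a primary subgraph $G_j$ with $x\in V(G_j)$, $G_j(x^+)$ is the connected component containing $x$ of the graph obtained from $G[\mathcal{H}]$ by removing all edges joining $x$ to vertices of $G_j$. $J_{\mathcal{H}}\subseteq\{1,\dots,k\}$ is the set of indices $j$ such that $G_j$ is not bipartite. For $j\in J_{\mathcal{H}}$, $C_j$ is the set of attachment vertices $x\in V(G_j)$ such that $G_j(x^+)$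 is not bipartite, and $\alpha_j=\max\{|C_j\cap B| : B \text{ a local metric basis of } G_j\}$. -}

module Defs where

open import Data.Nat using (ℕ; zero; suc; _≤_; _<_; _∸_; _+_)
open import Data.Bool using (Bool; true; false; T; if_then_else_)
open import Data.Fin using (Fin; toℕ)
open import Data.Fin.Subset using (Subset; _∈_; _∩_; ∣_∣)
open import Data.Vec using (lookup; tabulate; sum)
open import Data.Product using (Σ; ∃; ∃-syntax; _×_; _,_)
open import Data.Sum using (_⊎_)
open import Relation.Nullary using (¬_)
open import Relation.Binary.PropositionalEquality using (_≡_; _≢_)
open import Function.Bundles using (_⇔_)

record Graph (n : ℕ) : Set where
  field
    adj     : Fin n → Fin n → Bool
    adj-sym : ∀ x y → adj x y ≡ adj y x
    adj-irr : ∀ x → adj x x ≡ false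

open Graph public

Adj : ∀ {n} → Graph n → Fin n → Fin n → Set
Adj G x y = T (adj G x y)

data WalkR {n} (R : Fin n → Fin n → Set) : Fin n → Fin n → ℕ → Set where
  here : ∀ {x} → WalkR R x x 0
  step : ∀ {x y z ℓ} → R x y → WalkR R y z ℓ → WalkR R x z (suc ℓ)

Walk : ∀ {n} → Graph n → Fin n → Fin n → ℕ → Set
Walk G = WalkR (Adj G)

Connected : ∀ {n} → Graph n → Set
Connected G = ∀ x y → ∃[ ℓ ] Walk G x y ℓ

Dist : ∀ {n} → Graph n → Fin n → Fin n → ℕ → Set
Dist G x y m = Walk G x y m × (∀ ℓ → Walk G x y ℓ → m ≤ ℓ)

Bipartite : ∀ {n} → Graph n → Set
Bipartite {n} G = Σ (Fin n → Bool) λ c → ∀ u v → Adj G u v → c u ≢ c v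

IsLocalMetricGenerator : ∀ {n} → Graph n → Subset n → Set
IsLocalMetricGenerator {n} G W =
  ∀ u v → Adj G u v →
    Σ (Fin n) λ w → w ∈ W × (Σ ℕ λ m → Σ ℕ λ m' → Dist G u w m × Dist G v w m' × m ≢ m')

IsLocalMetricBasis : ∀ {n} → Graph n → Subset n → Set
IsLocalMetricBasis {n} G W =
  IsLocalMetricGenerator G W × (∀ (W' : Subset n) → IsLocalMetricGenerator G W' → ∣ W ∣ ≤ ∣ W' ∣)

LocalMetricDim : ∀ {n} → Graph n → ℕ → Set
LocalMetricDim {n} G d = Σ (Subset n) λ W → IsLocalMetricBasis G W × ∣ W ∣ ≡ d

IsMaxBasisMeet : ∀ {n} → Graph n → Subset n → ℕ → Set
IsMaxBasisMeet {n} G C a =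
  (Σ (Subset n) λ B → IsLocalMetricBasis G B × ∣ C ∩ B ∣ ≡ a)
  × (∀ (B : Subset n) → IsLocalMetricBasis G B → ∣ C ∩ B ∣ ≤ a)

-- Point-attaching.  G is obtained by point-attaching from H 0, …, H (k-1),
-- with φ i : V(H i) → V(G) the embedding of the i-th primary subgraph.

InImage : ∀ {k N} {n : Fin k → ℕ} → ((i : Fin k) → Fin (n i) → Fin N) → Fin k → Fin N → Set
InImage {n = n} φ i u = Σ (Fin (n i)) λ x → φ i x ≡ u

record PointAttaching {k : ℕ} {n : Fin k → ℕ} (H : (i : Fin k) → Graph (n i))
                      {N : ℕ} (G : Graph N) : Set where
  field
    φ       : (i : Fin k) → Fin (n i) → Fin N
    φ-inj   : ∀ i x y → φ i x ≡ φ i y → x ≡ y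
    cover   : ∀ u → Σ (Fin k) λ i → InImage φ i u
    edges   : ∀ u v → Adj G u v ⇔
                (Σ (Fin k) λ i → Σ (Fin (n i)) λ x → Σ (Fin (n i)) λ y →
                   φ i x ≡ u × φ i y ≡ v × Adj (H i) x y)
    -- the (i+1)-th graph is glued to the previously built graph at exactly
    -- one vertex (for i > 0): exactly one vertex of H i is identified with a
    -- vertex of some earlier H j
    attach  : ∀ i → 0 < toℕ i →
                Σ (Fin (n i)) λ y →
                  (Σ (Fin k) λ j → toℕ j < toℕ i × InImage φ j (φ i y))
                  × (∀ y' → (Σ (Fin k) λ j → toℕ j < toℕ i × InImage φ j (φ i y')) → y' ≡ y)

module _ {k : ℕ} {n : Fin k → ℕ} {H : (i : Fin k) → Graph (n i)}
         {N : ℕ} {G : Graph N} (P : PointAttaching H G) where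
  open PointAttaching P

  IsAttachment : Fin N → Set
  IsAttachment u = Σ (Fin k) λ i → Σ (Fin k) λ j → i ≢ j × InImage φ i u × InImage φ j u

  -- adjacency of the graph obtained from G by removing all edges joining x
  -- to vertices of G_j
  AdjMinus : Fin k → Fin N → Fin N → Fin N → Set
  AdjMinus j x u v =
    Adj G u v × ¬ ((u ≡ x × InImage φ j v) ⊎ (v ≡ x × InImage φ j u))

  -- G_j(x^+) (the component of x in that graph) is not bipartite
  PlusComponentNonBipartite : Fin k → Fin N → Set
  PlusComponentNonBipartite j x =
    ¬ (Σ (Fin N → Bool) λ c →
         ∀ u v → (Σ ℕ λ ℓ → WalkR (AdjMinus j x) x u ℓ) → AdjMinus j x u v → c u ≢ c v)

  InC : (j : Fin k) → Fin (n j) → Set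
  InC j y = IsAttachment (φ j y) × PlusComponentNonBipartite j (φ j y)

sumOver : ∀ {k} → Subset k → (Fin k → ℕ) → ℕ
sumOver {k} J f = sum (tabulate λ j → if lookup J j then f j else 0)

module Submission where

-- Every vertex z of G has, in each primary subgraph H i, a gate π i z: the vertex of
-- H i through which all walks from z enter H i, so that for x in H i
--   d_G(z, φ i x) = d_G(z, φ i (π i z)) + d_{H i}(π i z, x).
-- Hence a vertex t resolves an edge of H i in G as soon as its gate resolves it in H i.  Take,
-- for j ∈ J, a local metric basis B j of H j with |C j ∩ B j| = α j, and
-- W = ⋃_{j∈J} φ j (B j ─ C j).
-- Edges of bipartite H i are resolved by any vertex (parity); edges of non-bipartite H i by some
-- w ∈ B i, and if w ∈ C i then a non-bipartite subgraph hangs off H i at w, and a descent on the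
-- number of subgraphs hanging there produces a vertex of W with gate w.  So W is a local metric
-- generator, and |W| ≤ Σ_{j∈J} (|B j| ∸ α j).

open import Defs
open import Data.Nat using (ℕ; zero; suc; _≤_; _<_; _∸_; _+_; z≤n; s≤s; _<?_)
open import Data.Nat.Properties
  using (≤-refl; ≤-trans; ≤-reflexive; ≤-antisym; ≤-pred; +-suc; +-mono-≤; +-cancelˡ-≡;
         m≤n⇒m≤1+n; m<n⇒m<1+n; ≤∧≢⇒<; ≮⇒≥; n≤0⇒n≡0; <⇒≤; m≤n⇒m<n∨m≡n;
         m+n∸n≡m; ∸-monoˡ-≤; module ≤-Reasoning)
open import Data.Bool using (Bool; true; false; T; T?; not; _xor_; if_then_else_)
open import Data.Bool.Properties using (not-injective; ¬-not; not-distribˡ-xor; not-distribʳ-xor)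
open import Data.Fin using (Fin; zero; suc; toℕ; fromℕ<; _≟_)
open import Data.Fin.Properties using (any?; toℕ-injective; toℕ-fromℕ<; toℕ<n)
open import Data.Fin.Subset using (Subset; _∈_; _∉_; _∩_; _∪_; _─_; ∣_∣; ⊥; ⁅_⁆; inside; outside)
open import Data.Fin.Subset.Properties
  using (_∈?_; x∈⁅x⁆; x∈p∪q⁺; ∣⊥∣≡0; ∣⁅x⁆∣≡1; x∈p∧x∉q⇒x∈p─q; ∣p─q∣≤∣p∣)
open import Data.Vec using ([]; _∷_; here; there; lookup; tabulate; sum)
open import Data.Vec.Properties using (lookup⇒[]=; []=⇒lookup)
open import Data.Product using (Σ; _×_; _,_; proj₁; proj₂)
open import Data.Sum using (inj₁; inj₂)
open import Data.Empty using (⊥-elim)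
open import Function using (_∘_)
open import Function.Bundles using (_⇔_; Equivalence)
open import Relation.Nullary using (¬_; Dec; yes; no; ¬?; _×-dec_)
open import Relation.Binary.PropositionalEquality
  using (_≡_; _≢_; refl; sym; trans; cong; subst; subst₂; module ≡-Reasoning)

∣p∪q∣≤∣p∣+∣q∣ : ∀ {n} (p q : Subset n) → ∣ p ∪ q ∣ ≤ ∣ p ∣ + ∣ q ∣
∣p∪q∣≤∣p∣+∣q∣ []           []           = z≤n
∣p∪q∣≤∣p∣+∣q∣ (true ∷ p)  (true ∷ q)  =
  s≤s (≤-trans (m≤n⇒m≤1+n (∣p∪q∣≤∣p∣+∣q∣ p q)) (≤-reflexive (sym (+-suc _ _))))
∣p∪q∣≤∣p∣+∣q∣ (true ∷ p)  (false ∷ q) = s≤s (∣p∪q∣≤∣p∣+∣q∣ p q)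
∣p∪q∣≤∣p∣+∣q∣ (false ∷ p) (true ∷ q)  =
  ≤-trans (s≤s (∣p∪q∣≤∣p∣+∣q∣ p q)) (≤-reflexive (sym (+-suc _ _)))
∣p∪q∣≤∣p∣+∣q∣ (false ∷ p) (false ∷ q) = ∣p∪q∣≤∣p∣+∣q∣ p q

∣p─q∣+∣q∩p∣≡∣p∣ : ∀ {n} (p q : Subset n) → ∣ p ─ q ∣ + ∣ q ∩ p ∣ ≡ ∣ p ∣
∣p─q∣+∣q∩p∣≡∣p∣ []          []          = refl
∣p─q∣+∣q∩p∣≡∣p∣ (true ∷ p)  (true ∷ q)  = trans (+-suc _ _) (cong suc (∣p─q∣+∣q∩p∣≡∣p∣ p q))
∣p─q∣+∣q∩p∣≡∣p∣ (true ∷ p)  (false ∷ q) = cong suc (∣p─q∣+∣q∩p∣≡∣p∣ p q)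
∣p─q∣+∣q∩p∣≡∣p∣ (false ∷ p) (true ∷ q)  = ∣p─q∣+∣q∩p∣≡∣p∣ p q
∣p─q∣+∣q∩p∣≡∣p∣ (false ∷ p) (false ∷ q) = ∣p─q∣+∣q∩p∣≡∣p∣ p q

∣p─q∣≡∣p∣∸∣q∩p∣ : ∀ {n} (p q : Subset n) → ∣ p ─ q ∣ ≡ ∣ p ∣ ∸ ∣ q ∩ p ∣
∣p─q∣≡∣p∣∸∣q∩p∣ p q = begin
  ∣ p ─ q ∣                         ≡⟨ sym (m+n∸n≡m ∣ p ─ q ∣ ∣ q ∩ p ∣) ⟩
  ∣ p ─ q ∣ + ∣ q ∩ p ∣ ∸ ∣ q ∩ p ∣  ≡⟨ cong (_∸ ∣ q ∩ p ∣) (∣p─q∣+∣q∩p∣≡∣p∣ p q) ⟩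
  ∣ p ∣ ∸ ∣ q ∩ p ∣                 ∎
  where open ≡-Reasoning

image : ∀ {m N} → (Fin m → Fin N) → Subset m → Subset N
image f []            = ⊥
image f (inside ∷ S)  = ⁅ f zero ⁆ ∪ image (f ∘ suc) S
image f (outside ∷ S) = image (f ∘ suc) S

∈-image : ∀ {m N} (f : Fin m → Fin N) (S : Subset m) {x} → x ∈ S → f x ∈ image f S
∈-image f (inside ∷ S)  here      = x∈p∪q⁺ (inj₁ (x∈⁅x⁆ (f zero)))
∈-image f (inside ∷ S)  (there x) = x∈p∪q⁺ {p = ⁅ f zero ⁆} (inj₂ (∈-image (f ∘ suc) S x))
∈-image f (outside ∷ S) (there x) = ∈-image (f ∘ suc) S x

∣image∣≤ : ∀ {m N} (f : Fin m → Fin N) (S : Subset m) → ∣ image f S ∣ ≤ ∣ S ∣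
∣image∣≤ {N = N} f [] = ≤-reflexive (∣⊥∣≡0 N)
∣image∣≤ f (inside ∷ S)  = begin
  ∣ ⁅ f zero ⁆ ∪ image (f ∘ suc) S ∣        ≤⟨ ∣p∪q∣≤∣p∣+∣q∣ ⁅ f zero ⁆ _ ⟩
  ∣ ⁅ f zero ⁆ ∣ + ∣ image (f ∘ suc) S ∣    ≡⟨ cong (_+ ∣ image (f ∘ suc) S ∣) (∣⁅x⁆∣≡1 (f zero)) ⟩
  suc ∣ image (f ∘ suc) S ∣                 ≤⟨ s≤s (∣image∣≤ (f ∘ suc) S) ⟩
  suc ∣ S ∣                                 ∎
  where open ≤-Reasoning
∣image∣≤ f (outside ∷ S) = ∣image∣≤ (f ∘ suc) S

⋃ᶠ : ∀ {k N} → (Fin k → Subset N) → Subset N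
⋃ᶠ {zero}  F = ⊥
⋃ᶠ {suc k} F = F zero ∪ ⋃ᶠ (F ∘ suc)

∈-⋃ᶠ : ∀ {k N} (F : Fin k → Subset N) j {z} → z ∈ F j → z ∈ ⋃ᶠ F
∈-⋃ᶠ F zero    z∈F = x∈p∪q⁺ (inj₁ z∈F)
∈-⋃ᶠ F (suc j) z∈F = x∈p∪q⁺ {p = F zero} (inj₂ (∈-⋃ᶠ (F ∘ suc) j z∈F))

∣⋃ᶠ∣≤ : ∀ {k N} (F : Fin k → Subset N) (g : Fin k → ℕ) →
        (∀ j → ∣ F j ∣ ≤ g j) → ∣ ⋃ᶠ F ∣ ≤ sum (tabulate g)
∣⋃ᶠ∣≤ {zero} {N} F g bound = ≤-reflexive (∣⊥∣≡0 N)
∣⋃ᶠ∣≤ {suc k}    F g bound =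
  ≤-trans (∣p∪q∣≤∣p∣+∣q∣ (F zero) _)
          (+-mono-≤ (bound zero) (∣⋃ᶠ∣≤ (F ∘ suc) (g ∘ suc) (bound ∘ suc)))

count : ∀ {k} (Q : Fin k → Set) → (∀ i → Dec (Q i)) → ℕ
count {zero}  Q Q? = 0
count {suc k} Q Q? with Q? zero
... | yes _ = suc (count (Q ∘ suc) (Q? ∘ suc))
... | no _  = count (Q ∘ suc) (Q? ∘ suc)

count-mono : ∀ {k} (Q R : Fin k → Set) Q? R? → (∀ i → Q i → R i) → count Q Q? ≤ count R R?
count-mono {zero}  Q R Q? R? Q⊆R = z≤n
count-mono {suc k} Q R Q? R? Q⊆R with Q? zero | R? zero
... | yes _ | yes _  = s≤s (count-mono _ _ _ _ (Q⊆R ∘ suc))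
... | yes q | no ¬r  = ⊥-elim (¬r (Q⊆R zero q))
... | no _  | yes _  = m≤n⇒m≤1+n (count-mono _ _ _ _ (Q⊆R ∘ suc))
... | no _  | no _   = count-mono _ _ _ _ (Q⊆R ∘ suc)

count-strict : ∀ {k} (Q R : Fin k → Set) Q? R? → (∀ i → Q i → R i) →
               ∀ i → R i → ¬ Q i → count Q Q? < count R R?
count-strict {suc k} Q R Q? R? Q⊆R zero r ¬q with Q? zero | R? zero
... | yes q | _     = ⊥-elim (¬q q)
... | no _  | yes _ = s≤s (count-mono _ _ _ _ (Q⊆R ∘ suc))
... | no _  | no ¬r = ⊥-elim (¬r r)
count-strict {suc k} Q R Q? R? Q⊆R (suc i) r ¬q with Q? zero | R? zero
... | yes _ | yes _ = s≤s (count-strict _ _ _ _ (Q⊆R ∘ suc) i r ¬q)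
... | yes q | no ¬r = ⊥-elim (¬r (Q⊆R zero q))
... | no _  | yes _ = m<n⇒m<1+n (count-strict _ _ _ _ (Q⊆R ∘ suc) i r ¬q)
... | no _  | no _  = count-strict _ _ _ _ (Q⊆R ∘ suc) i r ¬q

_++ʷ_ : ∀ {n} {R : Fin n → Fin n → Set} {x y z ℓ ℓ'} →
        WalkR R x y ℓ → WalkR R y z ℓ' → WalkR R x z (ℓ + ℓ')
here     ++ʷ q = q
step e p ++ʷ q = step e (p ++ʷ q)

snocʷ : ∀ {n} {R : Fin n → Fin n → Set} {x y z ℓ} → WalkR R x y ℓ → R y z → WalkR R x z (suc ℓ)
snocʷ here       e' = step e' here
snocʷ (step e p) e' = step e (snocʷ p e')

reverseʷ : ∀ {n} (G : Graph n) {x y ℓ} → Walk G x y ℓ → Walk G y x ℓ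
reverseʷ G here                       = here
reverseʷ G {x} (step {y = y} e p) = snocʷ (reverseʷ G p) (subst T (adj-sym G x y) e)

mapʷ : ∀ {n m} {R : Fin n → Fin n → Set} {S : Fin m → Fin m → Set} (f : Fin n → Fin m) →
       (∀ {u v} → R u v → S (f u) (f v)) → ∀ {x y ℓ} → WalkR R x y ℓ → WalkR S (f x) (f y) ℓ
mapʷ f f-hom here       = here
mapʷ f f-hom (step e p) = step (f-hom e) (mapʷ f f-hom p)

walk-invariant : ∀ {n} {R : Fin n → Fin n → Set} (Q : Fin n → Set) →
                 (∀ {u v} → Q u → R u v → Q v) → ∀ {s u ℓ} → WalkR R s u ℓ → Q s → Q u
walk-invariant Q pres here       q = q
walk-invariant Q pres (step e p) q = walk-invariant Q pres p (pres q e)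

walk? : ∀ {n} (G : Graph n) x y ℓ → Dec (Walk G x y ℓ)
walk? G x y zero with x ≟ y
... | yes refl = yes here
... | no x≢y   = no λ { here → x≢y refl }
walk? G x y (suc ℓ) with any? (λ z → T? (adj G x z) ×-dec walk? G z y ℓ)
... | yes (z , e , p) = yes (step e p)
... | no none          = no λ { (step e p) → none (_ , e , p) }

least : (Q : ℕ → Set) → (∀ m → Dec (Q m)) → ∀ ℓ → Q ℓ →
        Σ ℕ λ m → Q m × (∀ ℓ' → Q ℓ' → m ≤ ℓ')
least Q Q? ℓ q with Q? 0
... | yes q0 = 0 , q0 , λ _ _ → z≤n
least Q Q? zero    q | no ¬q0 = ⊥-elim (¬q0 q)
least Q Q? (suc ℓ) q | no ¬q0 with least (Q ∘ suc) (Q? ∘ suc) ℓ q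
... | m , qm , minimal = suc m , qm , above
  where
  above : ∀ ℓ' → Q ℓ' → suc m ≤ ℓ'
  above zero     q' = ⊥-elim (¬q0 q')
  above (suc ℓ') q' = s≤s (minimal ℓ' q')

distance : ∀ {n} (G : Graph n) → Connected G → ∀ x y → Σ ℕ λ m → Dist G x y m
distance G connected x y with connected x y
... | ℓ , p = least (Walk G x y) (walk? G x y) ℓ p

dist-unique : ∀ {n} (G : Graph n) {x y m m'} → Dist G x y m → Dist G x y m' → m ≡ m'
dist-unique G (p , min) (p' , min') = ≤-antisym (min _ p') (min' _ p)

dist-sym : ∀ {n} (G : Graph n) {x y m} → Dist G x y m → Dist G y x m
dist-sym G (p , min) = reverseʷ G p , λ ℓ q → min ℓ (reverseʷ G q)

dist-adj : ∀ {n} (G : Graph n) {u v w m m'} → Adj G u v → Dist G u w m → Dist G v w m' → m ≤ suc m'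
dist-adj G e (_ , min) (p' , _) = min _ (step e p')

Resolves : ∀ {n} → Graph n → Fin n → Fin n → Fin n → Set
Resolves G t u v = Σ ℕ λ m → Σ ℕ λ m' → Dist G u t m × Dist G v t m' × m ≢ m'

dim≤generator : ∀ {n} {G : Graph n} {D W} →
                LocalMetricDim G D → IsLocalMetricGenerator G W → D ≤ ∣ W ∣
dim≤generator (W₀ , (_ , minimal) , refl) generator = minimal _ generator

basis≤dim : ∀ {n} {G : Graph n} {d B} → IsLocalMetricBasis G B → LocalMetricDim G d → ∣ B ∣ ≤ d
basis≤dim (_ , minimal) (W₀ , (W₀-generates , _) , refl) = minimal W₀ W₀-generates

parity : ℕ → Bool
parity zero    = false
parity (suc m) = not (parity m)

parity-cancelˡ : ∀ m {a b} → parity (m + a) ≡ parity (m + b) → parity a ≡ parity b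
parity-cancelˡ zero    eq = eq
parity-cancelˡ (suc m) eq = parity-cancelˡ m (not-injective eq)

parity-near : ∀ m m' → m ≤ suc m' → m' ≤ suc m → m ≢ m' → parity m ≢ parity m'
parity-near zero          zero           _       _       m≢m' _  = m≢m' refl
parity-near zero          (suc zero)     _       _       _    ()
parity-near zero          (suc (suc m')) _       (s≤s ()) _
parity-near (suc zero)    zero           _       _       _    ()
parity-near (suc (suc m)) zero           (s≤s ()) _
parity-near (suc m)       (suc m')       (s≤s a) (s≤s b) m≢m' eq =
  parity-near m m' a b (m≢m' ∘ cong suc) (not-injective eq)

colour-along-walk : ∀ {n} (G : Graph n) (c : Fin n → Bool) → (∀ u v → Adj G u v → c u ≢ c v) →
                    ∀ {x y ℓ} → Walk G x y ℓ → c y ≡ parity ℓ xor c x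
colour-along-walk G c proper here = refl
colour-along-walk G c proper {x} (step {y = y} {z} {ℓ} e p) = begin
  c z                        ≡⟨ colour-along-walk G c proper p ⟩
  parity ℓ xor c y           ≡⟨ cong (parity ℓ xor_) (¬-not (proper x y e ∘ sym)) ⟩
  parity ℓ xor not (c x)     ≡⟨ sym (not-distribʳ-xor (parity ℓ) (c x)) ⟩
  not (parity ℓ xor c x)     ≡⟨ not-distribˡ-xor (parity ℓ) (c x) ⟩
  parity (suc ℓ) xor c x     ∎
  where open ≡-Reasoning

bipartite-parity : ∀ {n} (G : Graph n) → Bipartite G → ∀ {g a b m m'} → Adj G a b →
                   Dist G g a m → Dist G g b m' → parity m ≢ parity m'
bipartite-parity G (c , proper) {g} {a} {b} {m} {m'} e (p , _) (p' , _) eq =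
  proper a b e (begin
    c a                 ≡⟨ colour-along-walk G c proper p ⟩
    parity m xor c g    ≡⟨ cong (_xor c g) eq ⟩
    parity m' xor c g   ≡⟨ sym (colour-along-walk G c proper p') ⟩
    c b                 ∎)
  where open ≡-Reasoning

-- If {g} is a local metric generator, colouring by parity of the distance to g is proper.
single-generator⇒bipartite : ∀ {n} (G : Graph n) → Connected G → ∀ {W g} →
  IsLocalMetricGenerator G W → (∀ x → x ∈ W → x ≡ g) → Bipartite G
single-generator⇒bipartite G connected {W} {g} generator only-g = colour , proper
  where
  d : ∀ x → Σ ℕ λ m → Dist G x g m
  d x = distance G connected x g
  colour : _ → Bool
  colour x = parity (proj₁ (d x))
  proper : ∀ u v → Adj G u v → colour u ≢ colour v
  proper u v e with generator u v e
  ... | w , w∈W , m , m' , du , dv , m≢m' with only-g w w∈W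
  ... | refl = λ eq → parity-near m m'
                 (dist-adj G e du dv) (dist-adj G (subst T (adj-sym G u v) e) dv du) m≢m'
                 (trans (cong parity (dist-unique G du (proj₂ (d u))))
                   (trans eq (cong parity (dist-unique G (proj₂ (d v)) dv))))

generator-escapes : ∀ {n} (G : Graph n) → Connected G → ¬ Bipartite G → ∀ {W} →
  IsLocalMetricGenerator G W → ∀ g → Σ (Fin n) λ x → x ∈ W × x ≢ g
generator-escapes G connected nonbip {W} generator g with any? (λ x → (x ∈? W) ×-dec ¬? (x ≟ g))
... | yes found = found
... | no none   = ⊥-elim (nonbip (single-generator⇒bipartite G connected generator only-g))
  where
  only-g : ∀ x → x ∈ W → x ≡ g
  only-g x x∈W with x ≟ g
  ... | yes x≡g = x≡g
  ... | no x≢g  = ⊥-elim (none (x , x∈W , x≢g))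

-- Gates of a point-attaching.  Every vertex z of G has a gate in each primary subgraph H i:
-- a vertex π i z of H i through which every walk from z into H i passes.  We construct π i as
-- a retraction of G onto H i that collapses every other primary subgraph to a single vertex.
module Gates {k : ℕ} {n : Fin k → ℕ} {H : (i : Fin k) → Graph (n i)} {N : ℕ} {G : Graph N}
             (P : PointAttaching H G) (root : (i : Fin k) → Fin (n i)) where
  open PointAttaching P

  inImage? : ∀ i z → Dec (InImage φ i z)
  inImage? i z = any? (λ x → φ i x ≟ z)

  record Retraction (i : Fin k) (m : ℕ) : Set where
    field
      π        : Fin N → Fin (n i)
      section  : ∀ x → π (φ i x) ≡ x
      collapse : ∀ j → toℕ j < m → j ≢ i → ∀ a b → π (φ j a) ≡ π (φ j b)

  -- The vertex at which H i is glued onto the earlier subgraphs (the root if there are none).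
  entry : ∀ i → Σ (Fin (n i)) λ y → ∀ j → toℕ j < toℕ i → ∀ x → InImage φ j (φ i x) → x ≡ y
  entry i with 0 <? toℕ i
  ... | yes 0<i = proj₁ (attach i 0<i) ,
                  λ j j<i x x∈Hj → proj₂ (proj₂ (attach i 0<i)) x (j , j<i , x∈Hj)
  ... | no ¬0<i = root i , λ j j<i → ⊥-elim (¬0<i (≤-trans (s≤s z≤n) j<i))

  -- Up to H i itself: keep H i, send every other vertex to the entry vertex of H i.
  initial : ∀ i m → m ≤ suc (toℕ i) → Retraction i m
  initial i m m≤1+i = record { π = π ; section = section ; collapse = collapse }
    where
    y = proj₁ (entry i)
    π : Fin N → Fin (n i)
    π z with inImage? i z
    ... | yes (x , _) = x
    ... | no _        = y
    section : ∀ x → π (φ i x) ≡ x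
    section x with inImage? i (φ i x)
    ... | yes (x' , eq) = φ-inj i x' x eq
    ... | no ∉Hi        = ⊥-elim (∉Hi (x , refl))
    earlier-to-entry : ∀ j → toℕ j < toℕ i → ∀ a → π (φ j a) ≡ y
    earlier-to-entry j j<i a with inImage? i (φ j a)
    ... | yes (x , eq) = proj₂ (entry i) j j<i x (a , sym eq)
    ... | no _         = refl
    collapse : ∀ j → toℕ j < m → j ≢ i → ∀ a b → π (φ j a) ≡ π (φ j b)
    collapse j j<m j≢i a b = trans (earlier-to-entry j j<i a) (sym (earlier-to-entry j j<i b))
      where j<i = ≤∧≢⇒< (≤-pred (≤-trans j<m m≤1+i)) (j≢i ∘ toℕ-injective)

  -- Collapsing a later subgraph H M onto its entry vertex fixes all earlier subgraphs.
  module Collapse (M : Fin k) (0<M : 0 < toℕ M) where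
    yM = proj₁ (attach M 0<M)
    only-yM = proj₂ (proj₂ (attach M 0<M))

    r : Fin N → Fin N
    r z with inImage? M z
    ... | yes _ = φ M yM
    ... | no _  = z

    r-earlier : ∀ j → toℕ j < toℕ M → ∀ a → r (φ j a) ≡ φ j a
    r-earlier j j<M a with inImage? M (φ j a)
    ... | yes (x , eq) = trans (cong (φ M) (sym (only-yM x (j , j<M , a , sym eq)))) eq
    ... | no _         = refl

    r-M : ∀ a → r (φ M a) ≡ φ M yM
    r-M a with inImage? M (φ M a)
    ... | yes _  = refl
    ... | no ∉HM = ⊥-elim (∉HM (a , refl))

  extend : ∀ i m → toℕ i < m → (m<k : m < k) → Retraction i m → Retraction i (suc m)
  extend i m i<m m<k ρ = record { π = π ∘ r ; section = section′ ; collapse = collapse′ }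
    where
    open Retraction ρ
    M = fromℕ< m<k
    M≡m : toℕ M ≡ m
    M≡m = toℕ-fromℕ< m<k
    open Collapse M (subst (0 <_) (sym M≡m) (≤-trans (s≤s z≤n) i<m))
    section′ : ∀ x → π (r (φ i x)) ≡ x
    section′ x = trans (cong π (r-earlier i (subst (toℕ i <_) (sym M≡m) i<m) x)) (section x)
    collapse′ : ∀ j → toℕ j < suc m → j ≢ i → ∀ a b → π (r (φ j a)) ≡ π (r (φ j b))
    collapse′ j j<1+m j≢i a b with m≤n⇒m<n∨m≡n (≤-pred j<1+m)
    ... | inj₁ j<m = trans (cong π (r-earlier j j<M a))
                       (trans (collapse j j<m j≢i a b) (cong π (sym (r-earlier j j<M b))))
      where j<M = subst (toℕ j <_) (sym M≡m) j<m
    ... | inj₂ j≡m with toℕ-injective (trans j≡m (sym M≡m))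
    ... | refl = cong π (trans (r-M a) (sym (r-M b)))

  retraction : ∀ i m → m ≤ k → Retraction i m
  retraction i zero    _     = initial i 0 z≤n
  retraction i (suc m) 1+m≤k with toℕ i <? m
  ... | yes i<m = extend i m i<m 1+m≤k (retraction i m (<⇒≤ 1+m≤k))
  ... | no ¬i<m = initial i (suc m) (s≤s (≮⇒≥ ¬i<m))

  π : ∀ i → Fin N → Fin (n i)
  π i = Retraction.π (retraction i k ≤-refl)

  π-section : ∀ i x → π i (φ i x) ≡ x
  π-section i = Retraction.section (retraction i k ≤-refl)

  π-collapse : ∀ i j → j ≢ i → ∀ a b → π i (φ j a) ≡ π i (φ j b)
  π-collapse i j j≢i = Retraction.collapse (retraction i k ≤-refl) j (toℕ<n j) j≢i

  edge-of : ∀ {u v} → Adj G u v → Σ (Fin k) λ m → Σ (Fin (n m)) λ a → Σ (Fin (n m)) λ b →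
            φ m a ≡ u × φ m b ≡ v × Adj (H m) a b
  edge-of e = Equivalence.to (edges _ _) e

  embed-walk : ∀ i {a b ℓ} → Walk (H i) a b ℓ → Walk G (φ i a) (φ i b) ℓ
  embed-walk i = mapʷ (φ i) (λ e → Equivalence.from (edges _ _) (i , _ , _ , refl , refl , e))

  project-walk : ∀ i {u v ℓ} → Walk G u v ℓ → Σ ℕ λ ℓ' → ℓ' ≤ ℓ × Walk (H i) (π i u) (π i v) ℓ'
  project-walk i here = 0 , z≤n , here
  project-walk i (step e p) with project-walk i p | edge-of e
  ... | ℓ' , ℓ'≤ℓ , q | m , a , b , refl , refl , e' with m ≟ i
  ...   | yes refl = suc ℓ' , s≤s ℓ'≤ℓ ,
                     step (subst₂ (Adj (H i)) (sym (π-section i a)) (sym (π-section i b)) e') q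
  ...   | no m≢i   = ℓ' , m≤n⇒m≤1+n ℓ'≤ℓ ,
                     subst (λ t → Walk (H i) t _ ℓ') (π-collapse i m m≢i b a) q

  Level : Fin k → Fin N → Fin N → Set
  Level i u v = Adj G u v × π i u ≡ π i v

  split-at-gate : ∀ i {z w ℓ} → Walk G z w ℓ → (x : Fin (n i)) → φ i x ≡ w →
    Σ ℕ λ ℓ₁ → Σ ℕ λ ℓ₂ →
      WalkR (Level i) z (φ i (π i z)) ℓ₁ × Walk (H i) (π i z) x ℓ₂ × ℓ₁ + ℓ₂ ≤ ℓ
  split-at-gate i here x refl =
    0 , 0 , subst (λ t → WalkR (Level i) (φ i x) (φ i t) 0) (sym (π-section i x)) here ,
    subst (λ t → Walk (H i) t x 0) (sym (π-section i x)) here , z≤n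
  split-at-gate i (step e p) x x↦w with edge-of e
  ... | m , a , b , refl , refl , e' with m ≟ i
  ...   | yes refl with project-walk i (step e p)
  ...     | ℓ' , ℓ'≤ℓ , q =
    0 , ℓ' , subst (λ t → WalkR (Level i) (φ i a) (φ i t) 0) (sym (π-section i a)) here ,
    subst (λ t → Walk (H i) _ t ℓ') (trans (cong (π i) (sym x↦w)) (π-section i x)) q , ℓ'≤ℓ
  split-at-gate i (step e p) x x↦w | m , a , b , refl , refl , e' | no m≢i
    with split-at-gate i p x x↦w
  ...     | ℓ₁ , ℓ₂ , w₁ , w₂ , ℓ₁+ℓ₂≤ℓ =
    suc ℓ₁ , ℓ₂ ,
    step (e , same-gate) (subst (λ t → WalkR (Level i) (φ m b) (φ i t) ℓ₁) (sym same-gate) w₁) ,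
    subst (λ t → Walk (H i) t x ℓ₂) (sym same-gate) w₂ , s≤s ℓ₁+ℓ₂≤ℓ
    where same-gate = π-collapse i m m≢i a b

  gate-distance : ∀ i {z x m₁ m₂} → Dist G z (φ i (π i z)) m₁ → Dist (H i) (π i z) x m₂ →
                  Dist G z (φ i x) (m₁ + m₂)
  gate-distance i {m₁ = m₁} {m₂} (w₁ , min₁) (w₂ , min₂) = (w₁ ++ʷ embed-walk i w₂) , shortest
    where
    shortest : ∀ ℓ → Walk G _ _ ℓ → m₁ + m₂ ≤ ℓ
    shortest ℓ q with split-at-gate i q _ refl
    ... | ℓ₁ , ℓ₂ , c₁ , c₂ , ℓ₁+ℓ₂≤ℓ =
      ≤-trans (+-mono-≤ (min₁ ℓ₁ (mapʷ (λ u → u) proj₁ c₁)) (min₂ ℓ₂ c₂)) ℓ₁+ℓ₂≤ℓ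

  -- Every vertex of every H j is joined to the root of the first subgraph z, by descent along
  -- the attachment order (with fuel t bounding the index of j).
  reach-first : (∀ i → Connected (H i)) → (z : Fin k) → toℕ z ≡ 0 → ∀ t j → toℕ j < t → ∀ a →
                Σ ℕ λ ℓ → Walk G (φ j a) (φ z (root z)) ℓ
  reach-first connected z z≡0 (suc t) j j<t a with 0 <? toℕ j
  ... | no ¬0<j with toℕ-injective (trans (n≤0⇒n≡0 (≮⇒≥ ¬0<j)) (sym z≡0))
  ...   | refl = let (ℓ , w) = connected z a (root z) in ℓ , embed-walk z w
  reach-first connected z z≡0 (suc t) j j<t a | yes 0<j with attach j 0<j
  ...   | y , (j' , j'<j , a' , a'↦y) , _
    with connected j a y | reach-first connected z z≡0 t j' (≤-trans j'<j (≤-pred j<t)) a'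
  ...     | ℓ₁ , w₁ | ℓ₂ , w₂ =
    ℓ₁ + ℓ₂ , (embed-walk j w₁ ++ʷ subst (λ t → Walk G t (φ z (root z)) ℓ₂) a'↦y w₂)

  first-index : Fin k → Σ (Fin k) λ z → toℕ z ≡ 0
  first-index zero    = zero , refl
  first-index (suc _) = zero , refl

  -- A point-attaching of connected graphs is connected: join both ends to the first subgraph.
  attached-connected : (∀ i → Connected (H i)) → Connected G
  attached-connected connected x y with cover x | cover y
  ... | i , a , refl | i' , a' , refl with first-index i
  ... | z , z≡0 with reach-first connected z z≡0 (suc (toℕ i)) i ≤-refl a
                   | reach-first connected z z≡0 (suc (toℕ i')) i' ≤-refl a'
  ...   | ℓ₁ , w₁ | ℓ₂ , w₂ = ℓ₁ + ℓ₂ , (w₁ ++ʷ reverseʷ G w₂)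

-- The local metric generator.
-- The vertices of C j can be dropped because each of them is the gate in H j of a vertex of W
-- lying in a non-bipartite subgraph hanging off H j there; edges of bipartite subgraphs are
-- resolved by any vertex through parity.
module Generator {k : ℕ} {n : Fin k → ℕ} {H : (i : Fin k) → Graph (n i)} {N : ℕ} {G : Graph N}
  (root : (i : Fin k) → Fin (n i))
  (connected : ∀ i → Connected (H i))
  (P : PointAttaching H G)
  (nonbipartite : ¬ Bipartite G)
  (J : Subset k) (J-spec : ∀ j → (j ∈ J ⇔ (¬ Bipartite (H j))))
  (C : (j : Fin k) → Subset (n j))
  (C-plus : ∀ j → j ∈ J → ∀ y → y ∈ C j → PlusComponentNonBipartite P j (PointAttaching.φ P j y))
  (B : (j : Fin k) → Subset (n j))
  (B-generates : ∀ j → j ∈ J → IsLocalMetricGenerator (H j) (B j))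
  (W : Subset N)
  (W-contains : ∀ j → j ∈ J → ∀ x → x ∈ B j → x ∉ C j → PointAttaching.φ P j x ∈ W)
  where
  open PointAttaching P
  open Gates P root

  dG : Fin N → Fin N → ℕ
  dG x y = proj₁ (distance G (attached-connected connected) x y)

  dG-dist : ∀ x y → Dist G x y (dG x y)
  dG-dist x y = proj₂ (distance G (attached-connected connected) x y)

  dH : ∀ i → Fin (n i) → Fin (n i) → ℕ
  dH i x y = proj₁ (distance (H i) (connected i) x y)

  dH-dist : ∀ i x y → Dist (H i) x y (dH i x y)
  dH-dist i x y = proj₂ (distance (H i) (connected i) x y)

  J-nonbipartite : ∀ j → j ∈ J → ¬ Bipartite (H j)
  J-nonbipartite j = Equivalence.to (J-spec j)

  outside-J-bipartite : ∀ j → j ∉ J → ¬ ¬ Bipartite (H j)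
  outside-J-bipartite j j∉J nonbip = j∉J (Equivalence.from (J-spec j) nonbip)

  -- Through the gate formula, the parity of the distance from any vertex X separates the ends
  -- of an edge of a bipartite H m.
  bipartite-edge-parity : ∀ m → ¬ ¬ Bipartite (H m) → ∀ X {a b} → Adj (H m) a b →
                          parity (dG X (φ m a)) ≢ parity (dG X (φ m b))
  bipartite-edge-parity m ¬¬bip X {a} {b} e eq = ¬¬bip λ bip →
      bipartite-parity (H m) bip e (dH-dist m g a) (dH-dist m g b) (parity-cancelˡ d₀ (begin
        parity (d₀ + dH m g a)  ≡⟨ cong parity (sym (via-gate a)) ⟩
        parity (dG X (φ m a))   ≡⟨ eq ⟩
        parity (dG X (φ m b))   ≡⟨ cong parity (via-gate b) ⟩
        parity (d₀ + dH m g b)  ∎))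
    where
    open ≡-Reasoning
    g = π m X
    d₀ = dG X (φ m g)
    via-gate : ∀ a → dG X (φ m a) ≡ d₀ + dH m g a
    via-gate a =
      dist-unique G (dG-dist X (φ m a)) (gate-distance m (dG-dist X (φ m g)) (dH-dist m g a))

  -- Since G is not bipartite, neither is some primary subgraph.
  J-inhabited : Fin N → Σ (Fin k) λ l → l ∈ J
  J-inhabited X with any? (_∈? J)
  ... | yes found = found
  ... | no none   = ⊥-elim (nonbipartite (colour , proper))
    where
    colour : Fin N → Bool
    colour u = parity (dG X u)
    proper : ∀ u v → Adj G u v → colour u ≢ colour v
    proper u v e with edge-of e
    ... | m , a , b , refl , refl , e' =
      bipartite-edge-parity m (outside-J-bipartite m (λ m∈J → none (m , m∈J))) X e'

  -- H l hangs off H j at c: l ≠ j and the gate of H l in H j (a single vertex) is c.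
  HangsAt : (j : Fin k) → Fin (n j) → Fin k → Set
  HangsAt j c l = l ≢ j × π j (φ l (root l)) ≡ c

  hangsAt? : ∀ j c l → Dec (HangsAt j c l)
  hangsAt? j c l = ¬? (l ≟ j) ×-dec (π j (φ l (root l)) ≟ c)

  -- The number of subgraphs hanging off H j at c; the measure of the descent below.
  #hanging : (j : Fin k) → Fin (n j) → ℕ
  #hanging j c = count (HangsAt j c) (hangsAt? j c)

  record EdgeAway (l : Fin k) (x : Fin (n l)) (u v : Fin N) : Set where
    constructor edge-away
    field
      m      : Fin k
      m≢l    : m ≢ l
      a b    : Fin (n m)
      a↦u    : φ m a ≡ u
      b↦v    : φ m b ≡ v
      adj-ab : Adj (H m) a b
      gate-v : π l v ≡ x

  -- Such an edge lies in another primary subgraph, hence keeps the gate x.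
  away-step : ∀ l x {u v} → π l u ≡ x → AdjMinus P l (φ l x) u v → EdgeAway l x u v
  away-step l x gate-u (e , kept) with edge-of e
  ... | m , a , b , refl , refl , e' with m ≟ l
  ...   | yes refl =
    ⊥-elim (kept (inj₁ (cong (φ l) (trans (sym (π-section l a)) gate-u) , b , refl)))
  ...   | no m≢l   = edge-away m m≢l a b refl refl e' (trans (sym (π-collapse l m m≢l a b)) gate-u)

  -- If G_l(x⁺) is not bipartite, a non-bipartite H l' hangs off H l at x: otherwise every edge
  -- of G_l(x⁺) lies in a bipartite H m with m ≠ l, and the parity of the distance from φ l x
  -- would colour G_l(x⁺) properly.
  plus-hanging : ∀ l x → PlusComponentNonBipartite P l (φ l x) →
                 Σ (Fin k) λ l' → HangsAt l x l' × l' ∈ J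
  plus-hanging l x plus with any? (λ l' → hangsAt? l x l' ×-dec (l' ∈? J))
  ... | yes found = found
  ... | no none   = ⊥-elim (plus (colour , proper))
    where
    X = φ l x
    colour : Fin N → Bool
    colour u = parity (dG X u)
    proper : ∀ u v → (Σ ℕ λ ℓ → WalkR (AdjMinus P l X) X u ℓ) → AdjMinus P l X u v →
             colour u ≢ colour v
    proper u v (ℓ , walk) e
      with walk-invariant (λ t → π l t ≡ x) (λ gate e → EdgeAway.gate-v (away-step l x gate e))
                          walk (π-section l x)
    ... | gate-u with away-step l x gate-u e
    ...   | edge-away m m≢l a b refl refl e' _ =
      bipartite-edge-parity m (outside-J-bipartite m (λ m∈J → none (m , (m≢l , hangs) , m∈J))) X e'
      where
      hangs : π l (φ m (root m)) ≡ x
      hangs = trans (π-collapse l m m≢l (root m) a) gate-u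

  -- If H l ≠ H j, a vertex z whose gate in H l differs from the gate of H j there has, in H j,
  -- the gate of H l: walking from z to its gate in H l never uses an edge of H j.
  hang-transfer : ∀ j l → l ≢ j → ∀ z → π l z ≢ π l (φ j (root j)) → π j z ≡ π j (φ l (root l))
  hang-transfer j l l≢j z off
    with split-at-gate l (proj₂ (attached-connected connected z (φ l (root l)))) (root l) refl
  ... | _ , _ , level , _ , _ =
    trans (sym (proj₂ (walk-invariant Q preserved level (refl , refl))))
          (π-collapse j l l≢j (π l z) (root l))
    where
    Q : Fin N → Set
    Q u = π l u ≡ π l z × π j u ≡ π j z
    preserved : ∀ {u v} → Q u → Level l u v → Q v
    preserved (gate-l , gate-j) (e , same) with edge-of e
    ... | m , a , b , refl , refl , _ with m ≟ j
    ...   | yes refl = ⊥-elim (off (trans (sym gate-l) (π-collapse l j (l≢j ∘ sym) a (root j))))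
    ...   | no m≢j   = trans (sym same) gate-l , trans (sym (π-collapse j m m≢j a b)) gate-j

  -- What hangs off H l at x, away from the gate of H j, also hangs off H j where H l does;
  -- H l itself is lost, so strictly fewer subgraphs hang there.
  hanging-nested : ∀ j c l → HangsAt j c l → ∀ x → x ≢ π l (φ j (root j)) →
                   #hanging l x < #hanging j c
  hanging-nested j c l (l≢j , l↦c) x x≢g =
    count-strict _ _ _ _ nested l (l≢j , l↦c) (λ hangs → proj₁ hangs refl)
    where
    nested : ∀ i → HangsAt l x i → HangsAt j c i
    nested i (i≢l , i↦x) = i≢j ,
      trans (hang-transfer j l l≢j (φ i (root i)) (λ eq → x≢g (trans (sym i↦x) eq))) l↦c
      where
      i≢j : i ≢ j
      i≢j refl = x≢g (sym i↦x)

  -- Descent on #hanging, with fuel s bounding it.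
  mutual
    basis-gate : ∀ s l x → #hanging l x ≤ s → l ∈ J → x ∈ B l → Σ (Fin N) λ t → t ∈ W × π l t ≡ x
    basis-gate s l x bound l∈J x∈B with x ∈? C l
    ... | no x∉C  = φ l x , W-contains l l∈J x x∈B x∉C , π-section l x
    ... | yes x∈C with plus-hanging l x (C-plus l l∈J x x∈C)
    ...   | l' , hangs , l'∈J = hanging-gate s l x bound l' hangs l'∈J

    -- If a non-bipartite H l hangs off H j at c, then c is the gate in H j of a vertex of W:
    -- resolve a vertex x ∈ B l other than the gate of H j, at which fewer subgraphs hang.
    hanging-gate : ∀ s j c → #hanging j c ≤ s → ∀ l → HangsAt j c l → l ∈ J →
                   Σ (Fin N) λ t → t ∈ W × π j t ≡ c
    hanging-gate s j c bound l hangs@(l≢j , l↦c) l∈J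
      with generator-escapes (H l) (connected l) (J-nonbipartite l l∈J) (B-generates l l∈J)
                             (π l (φ j (root j)))
    ... | x , x∈B , x≢g with s | ≤-trans (hanging-nested j c l hangs x x≢g) bound
    ...   | zero   | ()
    ...   | suc s' | fewer with basis-gate s' l x (≤-pred fewer) l∈J x∈B
    ...     | t , t∈W , t↦x =
      t , t∈W , trans (hang-transfer j l l≢j t (λ eq → x≢g (trans (sym t↦x) eq))) l↦c

  gate-resolves : ∀ i {a b} t → Resolves (H i) (π i t) a b → Resolves G t (φ i a) (φ i b)
  gate-resolves i t (m , m' , da , db , m≢m') =
    d₀ + m , d₀ + m' ,
    dist-sym G (gate-distance i (dG-dist t _) (dist-sym (H i) da)) ,
    dist-sym G (gate-distance i (dG-dist t _) (dist-sym (H i) db)) ,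
    m≢m' ∘ +-cancelˡ-≡ d₀ _ _
    where d₀ = dG t (φ i (π i t))

  bipartite-resolves : ∀ i → i ∉ J → ∀ g {a b} → Adj (H i) a b → Resolves (H i) g a b
  bipartite-resolves i i∉J g {a} {b} e =
    dH i a g , dH i b g , dH-dist i a g , dH-dist i b g , differ
    where
    differ : dH i a g ≢ dH i b g
    differ eq = outside-J-bipartite i i∉J λ bip →
      bipartite-parity (H i) bip e (dist-sym (H i) (dH-dist i a g)) (dist-sym (H i) (dH-dist i b g))
                       (cong parity eq)

  -- W is non-empty: some H l is non-bipartite, B l is non-empty, and its vertices are gates of
  -- vertices of W.
  W-inhabited : Fin N → Σ (Fin N) λ t → t ∈ W
  W-inhabited X with J-inhabited X
  ... | l , l∈J
    with generator-escapes (H l) (connected l) (J-nonbipartite l l∈J) (B-generates l l∈J) (root l)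
  ...   | x , x∈B , _ with basis-gate _ l x ≤-refl l∈J x∈B
  ...     | t , t∈W , _ = t , t∈W

  -- An edge of H i, i ∈ J, is resolved by some w ∈ B i, which is the gate of some t ∈ W;
  -- an edge of a bipartite H i is resolved by any t ∈ W.
  local-generator : IsLocalMetricGenerator G W
  local-generator u v e with edge-of e
  ... | i , a , b , refl , refl , e' with i ∈? J
  ...   | yes i∈J with B-generates i i∈J a b e'
  ...     | w , w∈B , resolves with basis-gate _ i w ≤-refl i∈J w∈B
  ...       | t , t∈W , refl = t , t∈W , gate-resolves i t resolves
  local-generator u v e | i , a , b , refl , refl , e' | no i∉J with W-inhabited (φ i a)
  ...     | t , t∈W = t , t∈W , gate-resolves i t (bipartite-resolves i i∉J (π i t) e')

-- The size bound.  Choose for j ∈ J a local metric basis B j of H j meeting C j in α j vertices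
-- (and B j = ∅ otherwise), and let W be the union of the images φ j (B j ─ C j).
module Budget {k : ℕ} {n : Fin k → ℕ} {H : (i : Fin k) → Graph (n i)} {N : ℕ}
  (φ : (i : Fin k) → Fin (n i) → Fin N)
  (J : Subset k) (C : (j : Fin k) → Subset (n j)) (α : Fin k → ℕ)
  (optimal : ∀ j → j ∈ J → Σ (Subset (n j)) λ B → IsLocalMetricBasis (H j) B × ∣ C j ∩ B ∣ ≡ α j)
  where

  B : (j : Fin k) → Subset (n j)
  B j with j ∈? J
  ... | yes j∈J = proj₁ (optimal j j∈J)
  ... | no _    = ⊥

  B-optimal : ∀ j → j ∈ J → IsLocalMetricBasis (H j) (B j) × ∣ C j ∩ B j ∣ ≡ α j
  B-optimal j j∈J with j ∈? J
  ... | yes j∈J' = proj₂ (optimal j j∈J')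
  ... | no j∉J   = ⊥-elim (j∉J j∈J)

  B-outside : ∀ j → j ∉ J → B j ≡ ⊥
  B-outside j j∉J with j ∈? J
  ... | yes j∈J = ⊥-elim (j∉J j∈J)
  ... | no _    = refl

  W : Subset N
  W = ⋃ᶠ (λ j → image (φ j) (B j ─ C j))

  W-contains : ∀ j → j ∈ J → ∀ x → x ∈ B j → x ∉ C j → φ j x ∈ W
  W-contains j _ x x∈B x∉C = ∈-⋃ᶠ _ j (∈-image (φ j) (B j ─ C j) (x∈p∧x∉q⇒x∈p─q x∈B x∉C))

  part-size : (d : Fin k → ℕ) → (∀ j → LocalMetricDim (H j) (d j)) →
              ∀ j → ∣ image (φ j) (B j ─ C j) ∣ ≤ (if lookup J j then d j ∸ α j else 0)
  part-size d dims j with lookup J j in j∈?J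
  ... | true = begin
    ∣ image (φ j) (B j ─ C j) ∣  ≤⟨ ∣image∣≤ (φ j) (B j ─ C j) ⟩
    ∣ B j ─ C j ∣                ≡⟨ ∣p─q∣≡∣p∣∸∣q∩p∣ (B j) (C j) ⟩
    ∣ B j ∣ ∸ ∣ C j ∩ B j ∣      ≡⟨ cong (∣ B j ∣ ∸_) (proj₂ (B-optimal j j∈J)) ⟩
    ∣ B j ∣ ∸ α j                ≤⟨ ∸-monoˡ-≤ (α j) B≤d ⟩
    d j ∸ α j                    ∎
    where
    open ≤-Reasoning
    j∈J : j ∈ J
    j∈J = lookup⇒[]= j J j∈?J
    B≤d : ∣ B j ∣ ≤ d j
    B≤d = basis≤dim {G = H j} (proj₁ (B-optimal j j∈J)) (dims j)
  ... | false = begin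
    ∣ image (φ j) (B j ─ C j) ∣  ≤⟨ ∣image∣≤ (φ j) (B j ─ C j) ⟩
    ∣ B j ─ C j ∣                ≤⟨ ∣p─q∣≤∣p∣ (B j) (C j) ⟩
    ∣ B j ∣                      ≡⟨ cong ∣_∣ (B-outside j j∉J) ⟩
    ∣ ⊥ {n j} ∣                  ≡⟨ ∣⊥∣≡0 (n j) ⟩
    0                            ∎
    where
    open ≤-Reasoning
    j∉J : j ∉ J
    j∉J j∈J with trans (sym ([]=⇒lookup j∈J)) j∈?J
    ... | ()

  W-size : (d : Fin k → ℕ) → (∀ j → LocalMetricDim (H j) (d j)) →
           ∣ W ∣ ≤ sumOver J (λ j → d j ∸ α j)
  W-size d dims = ∣⋃ᶠ∣≤ _ _ (part-size d dims)

theorem3 : ∀ {k : ℕ} (n : Fin k → ℕ) (H : (i : Fin k) → Graph (n i))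
    {N : ℕ} (G : Graph N)
    → (∀ i → 2 ≤ n i)
    → (∀ i → Connected (H i))
    → (P : PointAttaching H G)
    → ¬ Bipartite G
    → (J : Subset k) → (∀ j → (j ∈ J ⇔ (¬ Bipartite (H j))))
    → (C : (j : Fin k) → Subset (n j))
    → (∀ j → j ∈ J → ∀ y → (y ∈ C j ⇔ InC P j y))
    → (d : Fin k → ℕ) → (∀ j → LocalMetricDim (H j) (d j))
    → (α : Fin k → ℕ) → (∀ j → j ∈ J → IsMaxBasisMeet (H j) (C j) (α j))
    → (D : ℕ) → LocalMetricDim G D
    → D ≤ sumOver J (λ j → d j ∸ α j)
theorem3 n H G two connected P nonbipartite J J-spec C C-spec d dims α α-max D dimG =
  ≤-trans (dim≤generator {G = G} dimG W-generates) (W-size d dims)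
  where
  open PointAttaching P using (φ)
  open Budget {H = H} φ J C α (λ j j∈J → proj₁ (α-max j j∈J))

  -- A distinguished vertex of each H i (n i ≥ 2 > 0).
  root : ∀ i → Fin (n i)
  root i = fromℕ< (≤-trans (s≤s z≤n) (two i))

  -- Only this half of the description of C j is needed.
  C-plus : ∀ j → j ∈ J → ∀ y → y ∈ C j → PlusComponentNonBipartite P j (φ j y)
  C-plus j j∈J y y∈C = proj₂ (Equivalence.to (C-spec j j∈J y) y∈C)

  W-generates : IsLocalMetricGenerator G W
  W-generates = Generator.local-generator root connected P nonbipartite J J-spec C C-plus
                  B (λ j j∈J → proj₁ (proj₁ (B-optimal j j∈J))) W W-contains
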